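{- Let $C$ be a context and $M_1,\dots,M_n$ terms. Then $C[M_1,\dots,M_n] \in SN$ if and only if $M_1,\dots,M_n \in SN$.
   Context: Intuitionistic variables $x,y,\dots$, classical variables $a,b,\dots$. Terms: ${\cal T} ::= x \mid \lambda x\, {\cal T} \mid ({\cal T}\ {\cal E}) \mid \langle {\cal T},{\cal T}\rangle \mid \omega_1 {\cal T} \mid \omega_2 {\cal T} \mid \mu a\, {\cal T} \mid (a\ {\cal T})$, ${\cal E} ::= {\cal T} \mid \pi_1 \mid \pi_2 \mid [x.{\cal T}, y.{\cal T}]$. Contexts with holes $*_1,\dots,*_n$: $C ::= *_i \mid \lambda x\, C \mid \omega_i C \mid \langle C_1, C_2\rangle \mid \mu a\, C$; $C[M_1,\dots,M_n]$ replaces each $*_i$ by $M_i$. Reduction $\triangleright$ is the compatible closure of: $(\lambda x M\ N)\triangleright M[x:=N]$; $(\langle M_1,M_2\rangle\ \pi_i)\triangleright M_i$; $(\omega_i M\ [x_1.N_1,x_2.N_2])\triangleright N_i[x_i:=M]$; $(M\ [x_1.N_1,x_2.N_2]\ \varepsilon)\triangleright (M\ [x_1.(N_1\ \varepsilon),x_2.(N_2\ \varepsilon)])$; $(\mu a M\ \varepsilon)\triangleright \mu a\, M[a:=^*\varepsilon]$, where $M[a:=^*\varepsilon]$ replaces each subterm $(a\ N)$ of $M$ by $(a\ (N\ \varepsilon))$. $SN$ is the set of terms with no infinite $\triangleright$-reduction sequence. -}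

module Defs where

open import Data.Nat using (ℕ; zero; suc)
open import Data.Nat.Properties using (_≟_)
open import Data.Fin using (Fin)
open import Relation.Nullary using (yes; no)
open import Induction.WellFounded using (Acc)

-- Intuitionistic variables x, y, … and classical variables a, b, … are two
-- separate sorts of de Bruijn indices (each a natural number).
--   λ and the two branches of a case bind one intuitionistic variable;
--   μ binds one classical variable.

mutual
  data Term : Set where
    var  : ℕ → Term
    lam  : Term → Term
    app  : Term → Elim → Term
    pair : Term → Term → Term
    ω₁   : Term → Term
    ω₂   : Term → Term
    mu   : Term → Term
    capp : ℕ → Term → Term

  data Elim : Set where
    arg  : Term → Elim
    π₁   : Elim
    π₂   : Elim
    case : Term → Term → Elim

liftR : (ℕ → ℕ) → ℕ → ℕ
liftR ρ zero    = zero
liftR ρ (suc n) = suc (ρ n)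

mutual
  ren : (ℕ → ℕ) → (ℕ → ℕ) → Term → Term
  ren ρ κ (var x)    = var (ρ x)
  ren ρ κ (lam M)    = lam (ren (liftR ρ) κ M)
  ren ρ κ (app M E)  = app (ren ρ κ M) (renE ρ κ E)
  ren ρ κ (pair M N) = pair (ren ρ κ M) (ren ρ κ N)
  ren ρ κ (ω₁ M)     = ω₁ (ren ρ κ M)
  ren ρ κ (ω₂ M)     = ω₂ (ren ρ κ M)
  ren ρ κ (mu M)     = mu (ren ρ (liftR κ) M)
  ren ρ κ (capp a M) = capp (κ a) (ren ρ κ M)

  renE : (ℕ → ℕ) → (ℕ → ℕ) → Elim → Elim
  renE ρ κ (arg M)    = arg (ren ρ κ M)
  renE ρ κ π₁         = π₁
  renE ρ κ π₂         = π₂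
  renE ρ κ (case M N) = case (ren (liftR ρ) κ M) (ren (liftR ρ) κ N)

wkI : Term → Term
wkI = ren suc (λ a → a)

wkIE : Elim → Elim
wkIE = renE suc (λ a → a)

wkC : Term → Term
wkC = ren (λ x → x) suc

wkCE : Elim → Elim
wkCE = renE (λ x → x) suc

liftSI : (ℕ → Term) → ℕ → Term
liftSI σ zero    = var zero
liftSI σ (suc n) = wkI (σ n)

liftSC : (ℕ → Term) → ℕ → Term
liftSC σ n = wkC (σ n)

mutual
  sub : (ℕ → Term) → Term → Term
  sub σ (var x)    = σ x
  sub σ (lam M)    = lam (sub (liftSI σ) M)
  sub σ (app M E)  = app (sub σ M) (subE σ E)
  sub σ (pair M N) = pair (sub σ M) (sub σ N)
  sub σ (ω₁ M)     = ω₁ (sub σ M)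
  sub σ (ω₂ M)     = ω₂ (sub σ M)
  sub σ (mu M)     = mu (sub (liftSC σ) M)
  sub σ (capp a M) = capp a (sub σ M)

  subE : (ℕ → Term) → Elim → Elim
  subE σ (arg M)    = arg (sub σ M)
  subE σ π₁         = π₁
  subE σ π₂         = π₂
  subE σ (case M N) = case (sub (liftSI σ) M) (sub (liftSI σ) N)

single : Term → ℕ → Term
single N zero    = N
single N (suc n) = var n

_[0≔_] : Term → Term → Term
M [0≔ N ] = sub (single N) M

-- structural substitution M[a :=* ε]: every subterm (a N) becomes (a (N ε))
-- (a is the classical variable with index k)
mutual
  ssub : ℕ → Elim → Term → Term
  ssub k e (var x)    = var x
  ssub k e (lam M)    = lam (ssub k (wkIE e) M)
  ssub k e (app M E)  = app (ssub k e M) (ssubE k e E)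
  ssub k e (pair M N) = pair (ssub k e M) (ssub k e N)
  ssub k e (ω₁ M)     = ω₁ (ssub k e M)
  ssub k e (ω₂ M)     = ω₂ (ssub k e M)
  ssub k e (mu M)     = mu (ssub (suc k) (wkCE e) M)
  ssub k e (capp a M) with a ≟ k
  ... | yes _ = capp a (app (ssub k e M) e)
  ... | no  _ = capp a (ssub k e M)

  ssubE : ℕ → Elim → Elim → Elim
  ssubE k e (arg M)    = arg (ssub k e M)
  ssubE k e π₁         = π₁
  ssubE k e π₂         = π₂
  ssubE k e (case M N) = case (ssub k (wkIE e) M) (ssub k (wkIE e) N)

mutual
  infix 4 _▷_ _▷ₑ_
  data _▷_ : Term → Term → Set where
    β     : ∀ {M N} → app (lam M) (arg N) ▷ M [0≔ N ]
    βπ₁   : ∀ {M₁ M₂} → app (pair M₁ M₂) π₁ ▷ M₁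
    βπ₂   : ∀ {M₁ M₂} → app (pair M₁ M₂) π₂ ▷ M₂
    βω₁   : ∀ {M N₁ N₂} → app (ω₁ M) (case N₁ N₂) ▷ N₁ [0≔ M ]
    βω₂   : ∀ {M N₁ N₂} → app (ω₂ M) (case N₁ N₂) ▷ N₂ [0≔ M ]
    δ     : ∀ {M N₁ N₂ ε} →
            app (app M (case N₁ N₂)) ε
              ▷ app M (case (app N₁ (wkIE ε)) (app N₂ (wkIE ε)))
    μ     : ∀ {M ε} → app (mu M) ε ▷ mu (ssub zero (wkCE ε) M)
    lam▷  : ∀ {M M'} → M ▷ M' → lam M ▷ lam M'
    appˡ  : ∀ {M M' E} → M ▷ M' → app M E ▷ app M' E
    appʳ  : ∀ {M E E'} → E ▷ₑ E' → app M E ▷ app M E'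
    pairˡ : ∀ {M M' N} → M ▷ M' → pair M N ▷ pair M' N
    pairʳ : ∀ {M N N'} → N ▷ N' → pair M N ▷ pair M N'
    ω₁▷   : ∀ {M M'} → M ▷ M' → ω₁ M ▷ ω₁ M'
    ω₂▷   : ∀ {M M'} → M ▷ M' → ω₂ M ▷ ω₂ M'
    mu▷   : ∀ {M M'} → M ▷ M' → mu M ▷ mu M'
    capp▷ : ∀ {a M M'} → M ▷ M' → capp a M ▷ capp a M'

  data _▷ₑ_ : Elim → Elim → Set where
    arg▷   : ∀ {M M'} → M ▷ M' → arg M ▷ₑ arg M'
    caseˡ  : ∀ {M M' N} → M ▷ M' → case M N ▷ₑ case M' N
    caseʳ  : ∀ {M N N'} → N ▷ N' → case M N ▷ₑ case M N'

-- strongly normalising terms: accessible for the converse of ▷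
-- (the constructive/inductive rendering of "no infinite ▷-sequence")
SN : Term → Set
SN = Acc (λ N M → M ▷ N)

data Ctx (n : ℕ) : Set where
  hole  : Fin n → Ctx n
  lamC  : Ctx n → Ctx n
  ω₁C   : Ctx n → Ctx n
  ω₂C   : Ctx n → Ctx n
  pairC : Ctx n → Ctx n → Ctx n
  muC   : Ctx n → Ctx n

-- C[M₁,…,Mₙ]: literal replacement of each *_i by M_i (no renaming; a hole
-- under binders captures, as in textual context filling)
fill : ∀ {n} → Ctx n → (Fin n → Term) → Term
fill (hole i)      Ms = Ms i
fill (lamC C)      Ms = lam (fill C Ms)
fill (ω₁C C)       Ms = ω₁ (fill C Ms)
fill (ω₂C C)       Ms = ω₂ (fill C Ms)
fill (pairC C₁ C₂) Ms = pair (fill C₁ Ms) (fill C₂ Ms)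
fill (muC C)       Ms = mu (fill C Ms)

data _occursIn_ {n : ℕ} (i : Fin n) : Ctx n → Set where
  here   : i occursIn hole i
  inLam  : ∀ {C} → i occursIn C → i occursIn lamC C
  inω₁   : ∀ {C} → i occursIn C → i occursIn ω₁C C
  inω₂   : ∀ {C} → i occursIn C → i occursIn ω₂C C
  inPairˡ : ∀ {C₁ C₂} → i occursIn C₁ → i occursIn pairC C₁ C₂
  inPairʳ : ∀ {C₁ C₂} → i occursIn C₂ → i occursIn pairC C₁ C₂
  inMu   : ∀ {C} → i occursIn C → i occursIn muC C

module Submission where

open import Defs
open import Data.Nat using (ℕ)
open import Data.Fin using (Fin)
open import Data.Product using (_×_; _,_)
open import Function using (_∘_)
open import Induction.WellFounded using (acc; module Subrelation)
import Relation.Binary.Construct.On as On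

-- No head rule fires at the root of λ, ω₁, ω₂, ⟨_,_⟩ or μ, so every reduct of
-- such a term reduces one immediate subterm; hence SN of the immediate subterms
-- gives SN of the term. Conversely each constructor is ▷-monotone, so an
-- infinite reduction of a subterm lifts to the whole term. Induction on the
-- context then gives both directions; the occurrence hypothesis is what makes
-- every Mᵢ an actual subterm of C[M₁,…,Mₙ].

SN-reflect : (f : Term → Term) → (∀ {M M'} → M ▷ M' → f M ▷ f M') →
             ∀ {M} → SN (f M) → SN M
SN-reflect f f-mono = Subrelation.accessible f-mono ∘ On.accessible f

SN-lam : ∀ {M} → SN M → SN (lam M)
SN-lam (acc rs) = acc λ { (lam▷ p) → SN-lam (rs p) }

SN-ω₁ : ∀ {M} → SN M → SN (ω₁ M)
SN-ω₁ (acc rs) = acc λ { (ω₁▷ p) → SN-ω₁ (rs p) }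

SN-ω₂ : ∀ {M} → SN M → SN (ω₂ M)
SN-ω₂ (acc rs) = acc λ { (ω₂▷ p) → SN-ω₂ (rs p) }

SN-mu : ∀ {M} → SN M → SN (mu M)
SN-mu (acc rs) = acc λ { (mu▷ p) → SN-mu (rs p) }

SN-pair : ∀ {M N} → SN M → SN N → SN (pair M N)
SN-pair sM@(acc rsM) sN@(acc rsN) = acc λ
  { (pairˡ p) → SN-pair (rsM p) sN
  ; (pairʳ p) → SN-pair sM (rsN p) }

SN-fill : ∀ {n} (C : Ctx n) {Ms : Fin n → Term} →
          (∀ i → SN (Ms i)) → SN (fill C Ms)
SN-fill (hole i)      sMs = sMs i
SN-fill (lamC C)      sMs = SN-lam (SN-fill C sMs)
SN-fill (ω₁C C)       sMs = SN-ω₁ (SN-fill C sMs)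
SN-fill (ω₂C C)       sMs = SN-ω₂ (SN-fill C sMs)
SN-fill (pairC C₁ C₂) sMs = SN-pair (SN-fill C₁ sMs) (SN-fill C₂ sMs)
SN-fill (muC C)       sMs = SN-mu (SN-fill C sMs)

SN-fill⁻ : ∀ {n} {C : Ctx n} {Ms : Fin n → Term} {i} →
           i occursIn C → SN (fill C Ms) → SN (Ms i)
SN-fill⁻ here        s = s
SN-fill⁻ (inLam o)   s = SN-fill⁻ o (SN-reflect lam lam▷ s)
SN-fill⁻ (inω₁ o)    s = SN-fill⁻ o (SN-reflect ω₁ ω₁▷ s)
SN-fill⁻ (inω₂ o)    s = SN-fill⁻ o (SN-reflect ω₂ ω₂▷ s)
SN-fill⁻ (inMu o)    s = SN-fill⁻ o (SN-reflect mu mu▷ s)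
SN-fill⁻ {Ms = Ms} (inPairˡ {C₂ = C₂} o) s =
  SN-fill⁻ o (SN-reflect (λ M → pair M (fill C₂ Ms)) pairˡ s)
SN-fill⁻ {Ms = Ms} (inPairʳ {C₁ = C₁} o) s =
  SN-fill⁻ o (SN-reflect (pair (fill C₁ Ms)) pairʳ s)

lemma3p3 : ∀ {n : ℕ} (C : Ctx n) (Ms : Fin n → Term) →
    (∀ i → i occursIn C) →
    (SN (fill C Ms) → ∀ i → SN (Ms i)) × ((∀ i → SN (Ms i)) → SN (fill C Ms))
lemma3p3 C Ms occurs = (λ s i → SN-fill⁻ (occurs i) s) , SN-fill C
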